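{- Let $\Phi$ be a finite root system. Every cover relation of the weak order restricted to the antisymmetric subsets of $\Phi$ is a cover relation of the weak order on all subsets of $\Phi$. In particular, the weak order on antisymmetric subsets of $\Phi$ is graded by $R\mapsto |R^-|-|R^+|$.
   Context: Let $V$ be a real Euclidean space. For $\alpha\neq0$ let $s_\alpha$ be the orthogonal reflection fixing $\alpha^\perp$. A finite root system is a finite set $\Phi\subset V\setminus\{0\}$ with $\Phi\cap\mathbb{R}\alpha=\{\alpha,-\alpha\}$ and $s_\alpha\Phi=\Phi$ for all $\alpha\in\Phi$. Fix a generic linear functional $f$ and let $\Phi^+=\{\alpha\in\Phi: f(\alpha)>0\}$, $\Phi^-=\{\alpha\in\Phi:f(\alpha)<0\}$. For $R\subseteq\Phi$ write $R^+=R\cap\Phi^+$, $R^-=R\cap\Phi^-$. The weak order on subsets of $\Phi$ is: $R\le S$ iff $R^+\supseteq S^+$ and $R^-\subseteq S^-$. Its cover relations are $R\lessdot R\setminus\{\alpha\}$ for $\alpha\in R^+$ and $R\setminus\{\beta\}\lessdot R$ for $\beta\in R^-$. A subset $R$ is antisymmetric if $R\cap -R=\varnothing$. -}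

module Defs where

open import Level using (0ℓ)
open import Data.Nat using (ℕ)
open import Data.Integer using (ℤ; +_; _-_)
open import Data.Fin using (Fin)
open import Data.Fin.Subset using (Subset; _∈_; _∉_; _∩_; ∣_∣)
open import Data.Vec using (tabulate)
open import Data.Bool using (Bool; true; false)
open import Data.Product using (Σ; ∃; _×_; _,_)
open import Data.Sum using (_⊎_)
open import Data.Empty using (⊥)
open import Relation.Nullary using (¬_)
open import Relation.Binary using (Rel; Tri; tri<; tri≈; tri>)
open import Relation.Binary.PropositionalEquality using (_≡_; _≢_)
open import Relation.Binary.Structures using (IsStrictTotalOrder)
open import Algebra.Structures using (IsCommutativeRing)

-- The real numbers, given axiomatically as a Dedekind-complete ordered
-- field (with propositional equality).  Classically any model is ℝ.

record RealField : Set₁ where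
  infixl 6 _+_
  infixl 7 _*_
  infix  4 _<_
  field
    Carrier : Set
    _+_ _*_ : Carrier → Carrier → Carrier
    -_      : Carrier → Carrier
    0# 1#   : Carrier
    _<_     : Rel Carrier 0ℓ
    isCommutativeRing  : IsCommutativeRing _≡_ _+_ _*_ -_ 0# 1#
    inverse            : ∀ x → x ≢ 0# → Σ Carrier λ y → x * y ≡ 1#
    0≢1                : 0# ≢ 1#
    isStrictTotalOrder : IsStrictTotalOrder _≡_ _<_
    +-mono-<           : ∀ {x y} z → x < y → x + z < y + z
    *-pos              : ∀ {x y} → 0# < x → 0# < y → 0# < x * y
    complete : (P : Carrier → Set) → Σ Carrier P →
               Σ Carrier (λ b → ∀ x → P x → (x < b ⊎ x ≡ b)) →
               Σ Carrier λ s → (∀ x → P x → (x < s ⊎ x ≡ s)) ×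
                               (∀ b → (∀ x → P x → (x < b ⊎ x ≡ b)) → (s < b ⊎ s ≡ b))

module _ (ℝ : RealField) where
  open RealField ℝ
  open IsStrictTotalOrder isStrictTotalOrder using (compare)

  Vect : ℕ → Set
  Vect n = Fin n → Carrier

  sumF : ∀ {n} → (Fin n → Carrier) → Carrier
  sumF {ℕ.zero}  g = 0#
  sumF {ℕ.suc n} g = g Fin.zero + sumF (λ i → g (Fin.suc i))

  ⟨_,_⟩ : ∀ {n} → Vect n → Vect n → Carrier
  ⟨ x , y ⟩ = sumF λ t → x t * y t

  _≐_ : ∀ {n} → Vect n → Vect n → Set
  x ≐ y = ∀ t → x t ≡ y t

  2# : Carrier
  2# = 1# + 1#

  -- A finite root system in ℝⁿ, given as an injective enumeration
  -- root : Fin m → ℝⁿ of the finite set Φ.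
  record IsRootSystem (n m : ℕ) (root : Fin m → Vect n) : Set where
    field
      injective : ∀ i j → root i ≐ root j → i ≡ j
      nonzero   : ∀ i → ¬ (root i ≐ (λ _ → 0#))
      neg-mem   : ∀ i → ∃ λ j → root j ≐ (λ t → - root i t)
      only-±    : ∀ i j (c : Carrier) → root j ≐ (λ t → c * root i t) →
                  c ≡ 1# ⊎ c ≡ - 1#
      -- s_α Φ = Φ, where s_α x = x - (2⟨x,α⟩/⟨α,α⟩) α.  (Since Φ is finite
      -- and s_α is injective, s_α Φ ⊆ Φ is equivalent to s_α Φ = Φ.)
      reflect   : ∀ i j → ∃ λ k → ∀ (inv : Σ Carrier λ y → ⟨ root i , root i ⟩ * y ≡ 1#) →
                  root k ≐ (λ t → root j t +
                      - ((2# * ⟨ root j , root i ⟩ * Data.Product.proj₁ inv) * root i t))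

  -- the set Φ⁺ (resp. Φ⁻) as a subset of indices, via the functional f
  isPos : Carrier → Bool
  isPos x with compare 0# x
  ... | tri< _ _ _ = true
  ... | tri≈ _ _ _ = false
  ... | tri> _ _ _ = false

  isNeg : Carrier → Bool
  isNeg x with compare x 0#
  ... | tri< _ _ _ = true
  ... | tri≈ _ _ _ = false
  ... | tri> _ _ _ = false

  module RootOrder {n m : ℕ} (root : Fin m → Vect n) (f : Vect n) where

    Pos Neg : Subset m
    Pos = tabulate λ i → isPos ⟨ f , root i ⟩
    Neg = tabulate λ i → isNeg ⟨ f , root i ⟩

    _⁺ _⁻ : Subset m → Subset m
    R ⁺ = R ∩ Pos
    R ⁻ = R ∩ Neg

    _≤w_ : Subset m → Subset m → Set
    R ≤w S = (∀ i → i ∈ S ⁺ → i ∈ R ⁺) × (∀ i → i ∈ R ⁻ → i ∈ S ⁻)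

    _<w_ : Subset m → Subset m → Set
    R <w S = R ≤w S × R ≢ S

    _⋖_ : Subset m → Subset m → Set
    R ⋖ S = R <w S × (∀ T → R ≤w T → T ≤w S → T ≡ R ⊎ T ≡ S)

    Antisymmetric : Subset m → Set
    Antisymmetric R = ∀ i j → i ∈ R → j ∈ R → ¬ (root j ≐ (λ t → - root i t))

    _⋖ₐ_ : Subset m → Subset m → Set
    R ⋖ₐ S = Antisymmetric R × Antisymmetric S × R <w S ×
             (∀ T → Antisymmetric T → R ≤w T → T ≤w S → T ≡ R ⊎ T ≡ S)

    rank : Subset m → ℤ
    rank R = + ∣ R ⁻ ∣ - + ∣ R ⁺ ∣

-- The weak order is the product, over the roots, of two-element chains: the
-- membership bit of a positive root is lower when set, that of a negative
-- root when unset.  If R ⋖ₐ S, move R one coordinate towards S at an index k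
-- where they differ, choosing k with k ∈ R, k ∉ S if there is one and
-- otherwise noting R ⊆ S.  The result lies between R and S and is contained
-- in R or in S, hence antisymmetric, so by the cover property it is S.  Thus
-- R and S differ in one coordinate only, which is a cover of the full weak
-- order changing |R⁻| - |R⁺| by one.  No root system axiom is needed, only
-- the genericity of f.

module Submission where

open import Defs
open import Data.Nat using (ℕ; suc)
open import Data.Integer using (ℤ; _+_; +_; _-_)
open import Data.Integer.Tactic.RingSolver using (solve-∀)
open import Data.Bool using (Bool; true; false; not; _∧_; _≤_; b≤b)
open import Data.Bool.Properties as Bool using (≤-antisym; ≤-minimum; ≤-refl; not-¬; not-injective)
open import Data.Fin using (Fin; zero; suc)
open import Data.Fin.Properties using (_≟_; any?; ¬∀⟶∃¬)
open import Data.Fin.Subset using (Subset; _∈_; _∩_; _⊆_; ∣_∣; inside; outside)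
open import Data.Fin.Subset.Properties using (x∈p∩q⁺; x∈p∩q⁻)
open import Data.Vec using (Vec; _∷_; lookup; _[_]≔_)
open import Data.Vec.Properties
  using (lookup∘update; lookup∘update′; []=⇒lookup; lookup⇒[]=; []≔-lookup;
         lookup∘tabulate; tabulate∘lookup; tabulate-cong)
open import Data.Product using (∃; _×_; _,_; proj₁; proj₂)
open import Data.Sum as Sum using (_⊎_; inj₁; inj₂)
open import Relation.Nullary using (yes; no; contradiction)
open import Relation.Nullary.Decidable using (_×-dec_)
open import Relation.Binary using (tri<; tri≈; tri>)
open import Relation.Binary.PropositionalEquality
  using (_≡_; _≢_; refl; sym; trans; cong; subst; subst₂)
open import Relation.Binary.Structures using (IsStrictTotalOrder)

≤-fromImplication : ∀ {b c : Bool} → (b ≡ true → c ≡ true) → b ≤ c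
≤-fromImplication {false} _ = ≤-minimum _
≤-fromImplication {true}  b⇒c rewrite b⇒c refl = b≤b

≤-true : ∀ {b c} → b ≤ c → b ≡ true → c ≡ true
≤-true b≤b refl = refl

≢⇒≡⊎≡ : ∀ {b c : Bool} → b ≢ c → ∀ t → t ≡ b ⊎ t ≡ c
≢⇒≡⊎≡ {false} {false} b≢c _     = contradiction refl b≢c
≢⇒≡⊎≡ {true}  {true}  b≢c _     = contradiction refl b≢c
≢⇒≡⊎≡ {false} {true}  _   false = inj₁ refl
≢⇒≡⊎≡ {false} {true}  _   true  = inj₂ refl
≢⇒≡⊎≡ {true}  {false} _   false = inj₂ refl
≢⇒≡⊎≡ {true}  {false} _   true  = inj₁ refl

-- The weak order on the membership bit of a root with isPos = s.
_≤⟨_⟩_ : Bool → Bool → Bool → Set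
b ≤⟨ true  ⟩ c = c ≤ b
b ≤⟨ false ⟩ c = b ≤ c

≤⟨⟩-refl : ∀ s b → b ≤⟨ s ⟩ b
≤⟨⟩-refl true  _ = ≤-refl
≤⟨⟩-refl false _ = ≤-refl

≤⟨⟩-squeeze : ∀ s {b t c} → b ≤⟨ s ⟩ t → t ≤⟨ s ⟩ c → b ≡ c → t ≡ b
≤⟨⟩-squeeze true  t≤b c≤t refl = ≤-antisym t≤b c≤t
≤⟨⟩-squeeze false b≤t t≤c refl = ≤-antisym t≤c b≤t

≤⟨⟩-strict : ∀ s {b c} → b ≤⟨ s ⟩ c → b ≢ c → b ≡ s × c ≡ not s
≤⟨⟩-strict true  {true}  {false} _ _ = refl , refl
≤⟨⟩-strict false {false} {true}  _ _ = refl , refl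
≤⟨⟩-strict true  {true}  {true}  _ b≢c = contradiction refl b≢c
≤⟨⟩-strict true  {false} {false} _ b≢c = contradiction refl b≢c
≤⟨⟩-strict false {true}  {true}  _ b≢c = contradiction refl b≢c
≤⟨⟩-strict false {false} {false} _ b≢c = contradiction refl b≢c

≤⟨⟩-flip : ∀ s → s ≤⟨ s ⟩ not s
≤⟨⟩-flip true  = ≤-minimum true
≤⟨⟩-flip false = ≤-minimum true

≡-fromLookup : ∀ {A : Set} {n} (xs ys : Vec A n) → (∀ i → lookup xs i ≡ lookup ys i) → xs ≡ ys
≡-fromLookup xs ys xs≗ys =
  trans (sym (tabulate∘lookup xs)) (trans (tabulate-cong xs≗ys) (tabulate∘lookup ys))

≡-fromLookupAt : ∀ {A : Set} {n} {xs ys : Vec A n} k → lookup xs k ≡ lookup ys k →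
                 (∀ i → i ≢ k → lookup xs i ≡ lookup ys i) → xs ≡ ys
≡-fromLookupAt {xs = xs} {ys} k at-k off-k = ≡-fromLookup xs ys agree
  where
  agree : ∀ i → lookup xs i ≡ lookup ys i
  agree i with i ≟ k
  ... | yes refl = at-k
  ... | no  i≢k  = off-k i i≢k

∈∩⇒lookup : ∀ {n} {p q : Subset n} {i} → i ∈ p ∩ q → lookup p i ≡ inside × lookup q i ≡ inside
∈∩⇒lookup {p = p} {q} i∈p∩q with x∈p∩q⁻ p q i∈p∩q
... | i∈p , i∈q = []=⇒lookup i∈p , []=⇒lookup i∈q

lookup⇒∈∩ : ∀ {n} {p q : Subset n} {i} → lookup p i ≡ inside → lookup q i ≡ inside → i ∈ p ∩ q
lookup⇒∈∩ {p = p} {q} {i} pᵢ qᵢ = x∈p∩q⁺ (lookup⇒[]= i p pᵢ , lookup⇒[]= i q qᵢ)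

[]≔-⊆ : ∀ {n} {p q : Subset n} {k b} →
        (∀ i → i ≢ k → lookup p i ≡ inside → lookup q i ≡ inside) →
        (b ≡ inside → lookup q k ≡ inside) → p [ k ]≔ b ⊆ q
[]≔-⊆ {p = p} {q} {k} {b} off-k at-k {i} i∈p[k]≔b = lookup⇒[]= i q (within i ([]=⇒lookup i∈p[k]≔b))
  where
  within : ∀ i → lookup (p [ k ]≔ b) i ≡ inside → lookup q i ≡ inside
  within i pᵢ with i ≟ k
  ... | yes refl = at-k (trans (sym (lookup∘update i p b)) pᵢ)
  ... | no  i≢k  = off-k i i≢k (trans (sym (lookup∘update′ i≢k p b)) pᵢ)

∃-step-⊆-either : ∀ {n} {R S : Subset n} → R ≢ S →
  ∃ λ k → lookup R k ≢ lookup S k × (R [ k ]≔ lookup S k ⊆ R ⊎ R [ k ]≔ lookup S k ⊆ S)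
∃-step-⊆-either {n} {R} {S} R≢S
  with any? (λ i → (lookup R i Bool.≟ inside) ×-dec (lookup S i Bool.≟ outside))
... | yes (k , Rₖ , Sₖ) =
  k , (λ Rₖ≡Sₖ → contradiction (trans (sym Rₖ) (trans Rₖ≡Sₖ Sₖ)) λ ()) ,
  inj₁ ([]≔-⊆ (λ _ _ Rᵢ → Rᵢ) λ Sₖ≡inside → contradiction (trans (sym Sₖ) Sₖ≡inside) λ ())
... | no ∄R∖S with ¬∀⟶∃¬ n _ (λ i → lookup R i Bool.≟ lookup S i) (λ R≗S → R≢S (≡-fromLookup R S R≗S))
...   | k , Rₖ≢Sₖ = k , Rₖ≢Sₖ , inj₂ ([]≔-⊆ (λ i _ → R⊆S i) (λ Sₖ → Sₖ))
  where
  R⊆S : ∀ i → lookup R i ≡ inside → lookup S i ≡ inside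
  R⊆S i Rᵢ with lookup S i in Sᵢ
  ... | inside  = refl
  ... | outside = contradiction (i , Rᵢ , Sᵢ) ∄R∖S

∣[]≔inside∣ : ∀ {n} (p : Subset n) k → ∣ p [ k ]≔ inside ∣ ≡ suc ∣ p [ k ]≔ outside ∣
∣[]≔inside∣ (_       ∷ p) zero    = refl
∣[]≔inside∣ (inside  ∷ p) (suc k) = cong suc (∣[]≔inside∣ p k)
∣[]≔inside∣ (outside ∷ p) (suc k) = ∣[]≔inside∣ p k

[]≔-∩ : ∀ {n} (p q : Subset n) k b → (p [ k ]≔ b) ∩ q ≡ (p ∩ q) [ k ]≔ (b ∧ lookup q k)
[]≔-∩ (_ ∷ p) (_ ∷ q) zero    b = refl
[]≔-∩ (x ∷ p) (y ∷ q) (suc k) b = cong (x ∧ y ∷_) ([]≔-∩ p q k b)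

x-y≡x-[1+y]+1 : ∀ (x y : ℤ) → x - y ≡ (x - (+ 1 + y)) + + 1
x-y≡x-[1+y]+1 = solve-∀

[1+x]-y≡x-y+1 : ∀ (x y : ℤ) → (+ 1 + x) - y ≡ (x - y) + + 1
[1+x]-y≡x-y+1 = solve-∀

module _ (ℝ : RealField) where
  open RealField ℝ using (0#; isStrictTotalOrder)
  open IsStrictTotalOrder isStrictTotalOrder using (compare)

  isNeg≡not-isPos : ∀ x → x ≢ 0# → isNeg ℝ x ≡ not (isPos ℝ x)
  isNeg≡not-isPos x x≢0 with compare 0# x | compare x 0#
  ... | tri< 0<x _ _   | tri< _ _ ¬0<x  = contradiction 0<x ¬0<x
  ... | tri< _ _ _     | tri≈ _ x≡0 _   = contradiction x≡0 x≢0
  ... | tri< _ _ _     | tri> _ _ _     = refl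
  ... | tri≈ _ 0≡x _   | _              = contradiction (sym 0≡x) x≢0
  ... | tri> _ _ _     | tri< _ _ _     = refl
  ... | tri> _ _ _     | tri≈ _ x≡0 _   = contradiction x≡0 x≢0
  ... | tri> ¬0<x _ _  | tri> _ _ 0<x   = contradiction 0<x ¬0<x

module _ (ℝ : RealField) {n m : ℕ} (root : Fin m → Vect ℝ n) (f : Vect ℝ n)
         (f≢0 : ∀ i → ⟨_,_⟩ ℝ f (root i) ≢ RealField.0# ℝ) where
  open RootOrder ℝ root f

  Neg≡not-Pos : ∀ i → lookup Neg i ≡ not (lookup Pos i)
  Neg≡not-Pos i rewrite lookup∘tabulate (λ j → isPos ℝ (⟨_,_⟩ ℝ f (root j))) i
                      | lookup∘tabulate (λ j → isNeg ℝ (⟨_,_⟩ ℝ f (root j))) i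
    = isNeg≡not-isPos ℝ _ (f≢0 i)

  infix 4 _≼_
  _≼_ : Subset m → Subset m → Set
  R ≼ S = ∀ i → lookup R i ≤⟨ lookup Pos i ⟩ lookup S i

  ≤w⇒≼ : ∀ {R S} → R ≤w S → R ≼ S
  ≤w⇒≼ {R} {S} (S⁺⊆R⁺ , R⁻⊆S⁻) i with lookup Pos i in Posᵢ
  ... | true  = ≤-fromImplication λ Sᵢ → proj₁ (∈∩⇒lookup (S⁺⊆R⁺ i (lookup⇒∈∩ Sᵢ Posᵢ)))
  ... | false = ≤-fromImplication λ Rᵢ → proj₁ (∈∩⇒lookup (R⁻⊆S⁻ i (lookup⇒∈∩ Rᵢ Negᵢ)))
    where
    Negᵢ : lookup Neg i ≡ true
    Negᵢ = trans (Neg≡not-Pos i) (cong not Posᵢ)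

  ≼⇒≤w : ∀ {R S} → R ≼ S → R ≤w S
  ≼⇒≤w {R} {S} R≼S = S⁺⊆R⁺ , R⁻⊆S⁻
    where
    S⁺⊆R⁺ : ∀ i → i ∈ S ⁺ → i ∈ R ⁺
    S⁺⊆R⁺ i i∈S⁺ with ∈∩⇒lookup i∈S⁺
    ... | Sᵢ , Posᵢ = lookup⇒∈∩ (≤-true (subst (λ s → lookup R i ≤⟨ s ⟩ lookup S i) Posᵢ (R≼S i)) Sᵢ) Posᵢ
    R⁻⊆S⁻ : ∀ i → i ∈ R ⁻ → i ∈ S ⁻
    R⁻⊆S⁻ i i∈R⁻ with ∈∩⇒lookup i∈R⁻
    ... | Rᵢ , Negᵢ = lookup⇒∈∩ (≤-true (subst (λ s → lookup R i ≤⟨ s ⟩ lookup S i) ¬Posᵢ (R≼S i)) Rᵢ) Negᵢ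
      where
      ¬Posᵢ : lookup Pos i ≡ false
      ¬Posᵢ = not-injective (trans (sym (Neg≡not-Pos i)) Negᵢ)

  ≼-toward : ∀ {R S} → R ≼ S → ∀ k → R ≼ R [ k ]≔ lookup S k × R [ k ]≔ lookup S k ≼ S
  ≼-toward {R} {S} R≼S k = R≼T , T≼S
    where
    R≼T : R ≼ R [ k ]≔ lookup S k
    R≼T i with i ≟ k
    ... | yes refl rewrite lookup∘update i R (lookup S i) = R≼S i
    ... | no  i≢k  rewrite lookup∘update′ i≢k R (lookup S k) = ≤⟨⟩-refl _ _
    T≼S : R [ k ]≔ lookup S k ≼ S
    T≼S i with i ≟ k
    ... | yes refl rewrite lookup∘update i R (lookup S i) = ≤⟨⟩-refl _ _
    ... | no  i≢k  rewrite lookup∘update′ i≢k R (lookup S k) = R≼S i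

  ⋖-fromSingleDifference : ∀ {R S} k → R ≤w S → lookup R k ≢ lookup S k →
                           (∀ i → i ≢ k → lookup R i ≡ lookup S i) → R ⋖ S
  ⋖-fromSingleDifference {R} {S} k R≤S Rₖ≢Sₖ agree = (R≤S , λ { refl → Rₖ≢Sₖ refl }) , between
    where
    between : ∀ T → R ≤w T → T ≤w S → T ≡ R ⊎ T ≡ S
    between T R≤T T≤S =
      Sum.map (λ Tₖ≡Rₖ → ≡-fromLookupAt k Tₖ≡Rₖ T≡R-off)
              (λ Tₖ≡Sₖ → ≡-fromLookupAt k Tₖ≡Sₖ λ i i≢k → trans (T≡R-off i i≢k) (agree i i≢k))
              (≢⇒≡⊎≡ Rₖ≢Sₖ (lookup T k))
      where
      T≡R-off : ∀ i → i ≢ k → lookup T i ≡ lookup R i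
      T≡R-off i i≢k = ≤⟨⟩-squeeze (lookup Pos i) (≤w⇒≼ R≤T i) (≤w⇒≼ T≤S i) (agree i i≢k)

  ⋖-flip : ∀ R k → (R [ k ]≔ lookup Pos k) ⋖ (R [ k ]≔ not (lookup Pos k))
  ⋖-flip R k = ⋖-fromSingleDifference k (≼⇒≤w coordinatewise) differ agree
    where
    s = lookup Pos k
    coordinatewise : R [ k ]≔ s ≼ R [ k ]≔ not s
    coordinatewise i with i ≟ k
    ... | yes refl rewrite lookup∘update i R s | lookup∘update i R (not s) = ≤⟨⟩-flip s
    ... | no  i≢k  rewrite lookup∘update′ i≢k R s | lookup∘update′ i≢k R (not s) = ≤⟨⟩-refl _ _
    differ : lookup (R [ k ]≔ s) k ≢ lookup (R [ k ]≔ not s) k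
    differ rewrite lookup∘update k R s | lookup∘update k R (not s) = not-¬ refl
    agree : ∀ i → i ≢ k → lookup (R [ k ]≔ s) i ≡ lookup (R [ k ]≔ not s) i
    agree i i≢k = trans (lookup∘update′ i≢k R s) (sym (lookup∘update′ i≢k R (not s)))

  rank-[]≔ : ∀ R k b → rank (R [ k ]≔ b) ≡
             + ∣ R ⁻ [ k ]≔ (b ∧ not (lookup Pos k)) ∣ - + ∣ R ⁺ [ k ]≔ (b ∧ lookup Pos k) ∣
  rank-[]≔ R k b rewrite []≔-∩ R Pos k b | []≔-∩ R Neg k b | Neg≡not-Pos k = refl

  rank-flip : ∀ R k → rank (R [ k ]≔ not (lookup Pos k)) ≡ rank (R [ k ]≔ lookup Pos k) + + 1
  rank-flip R k rewrite rank-[]≔ R k (lookup Pos k) | rank-[]≔ R k (not (lookup Pos k))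
    with lookup Pos k
  ... | true  rewrite ∣[]≔inside∣ (R ⁺) k =
    x-y≡x-[1+y]+1 (+ ∣ R ⁻ [ k ]≔ outside ∣) (+ ∣ R ⁺ [ k ]≔ outside ∣)
  ... | false rewrite ∣[]≔inside∣ (R ⁻) k =
    [1+x]-y≡x-y+1 (+ ∣ R ⁻ [ k ]≔ outside ∣) (+ ∣ R ⁺ [ k ]≔ outside ∣)

  Antisymmetric-⊆ : ∀ {R T} → T ⊆ R → Antisymmetric R → Antisymmetric T
  Antisymmetric-⊆ T⊆R antiR i j i∈T j∈T = antiR i j (T⊆R i∈T) (T⊆R j∈T)

  ⋖ₐ⇒flip : ∀ {R S} → R ⋖ₐ S →
            ∃ λ k → R [ k ]≔ lookup Pos k ≡ R × R [ k ]≔ not (lookup Pos k) ≡ S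
  ⋖ₐ⇒flip {R} {S} (antiR , antiS , (R≤S , R≢S) , between) with ∃-step-⊆-either R≢S
  ... | k , Rₖ≢Sₖ , T⊆R⊎T⊆S =
    k , subst (λ b → R [ k ]≔ b ≡ R) (proj₁ signs) ([]≔-lookup R k)
      , subst (λ b → R [ k ]≔ b ≡ S) (proj₂ signs) T≡S
    where
    T = R [ k ]≔ lookup S k
    signs : lookup R k ≡ lookup Pos k × lookup S k ≡ not (lookup Pos k)
    signs = ≤⟨⟩-strict (lookup Pos k) (≤w⇒≼ R≤S k) Rₖ≢Sₖ
    antiT : T ⊆ R ⊎ T ⊆ S → Antisymmetric T
    antiT (inj₁ T⊆R) = Antisymmetric-⊆ T⊆R antiR
    antiT (inj₂ T⊆S) = Antisymmetric-⊆ T⊆S antiS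
    T≡S : T ≡ S
    T≡S with ≼-toward {R} {S} (≤w⇒≼ R≤S) k
    ... | R≼T , T≼S with between T (antiT T⊆R⊎T⊆S) (≼⇒≤w R≼T) (≼⇒≤w T≼S)
    ...   | inj₂ T≡S = T≡S
    ...   | inj₁ T≡R =
      contradiction (trans (cong (λ V → lookup V k) (sym T≡R)) (lookup∘update k R (lookup S k))) Rₖ≢Sₖ

proposition3p5 : (ℝ : RealField) (n m : ℕ) (root : Fin m → Vect ℝ n) →
    IsRootSystem ℝ n m root →
    (f : Vect ℝ n) → (∀ i → ⟨_,_⟩ ℝ f (root i) ≢ RealField.0# ℝ) →
    (R S : Subset m) → RootOrder._⋖ₐ_ ℝ root f R S →
    RootOrder._⋖_ ℝ root f R S ×
    RootOrder.rank ℝ root f S ≡ RootOrder.rank ℝ root f R + + 1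
proposition3p5 ℝ n m root _ f f≢0 R S R⋖ₐS with ⋖ₐ⇒flip ℝ root f f≢0 R⋖ₐS
... | k , R-flip , S-flip =
    subst₂ _⋖_ R-flip S-flip (⋖-flip ℝ root f f≢0 R k)
  , subst₂ (λ A B → rank B ≡ rank A + + 1) R-flip S-flip (rank-flip ℝ root f f≢0 R k)
  where open RootOrder ℝ root f
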